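{- Let $\mathbf S=(S,\leq,*,1)$ be a skew Hilbert algebra, $n\geq1$, $a,a_1,\dots,a_n,b\in S$, and $\Theta$ an algebraic congruence on $\mathbf S$. Then: (i) $a\leq b$ implies $[a]\Theta\leq'[b]\Theta$; (ii) if $\mathbf S$ is strong, then $\Theta$ is strong. If $\Theta$ is a strong algebraic congruence, then: (iii) every class of $\Theta$ is up-directed with respect to $\leq$; (iv) $\{[x]\Theta\mid [a_i]\Theta\leq'[x]\Theta\text{ for all }i=1,\dots,n\}=\{[x]\Theta\mid x\in U(a_1,\dots,a_n)\}$. If $\Theta$ is moreover a strong congruence, then: (v) $(S/\Theta,\leq')$ is a poset.
   Context: For a poset and a subset $A$, $L(A)$, $U(A)$ are the sets of lower and upper bounds; $U(a_1,\dots,a_n)=U(\{a_1,\dots,a_n\})$; $L(U(x,y),z)=L(U(\{x,y\})\cup\{z\})$. A skew Hilbert algebra is a poset $(S,\leq,*,1)$ with binary operation $*$ and constant $1$ such that for all $x,y,z$: (S1) $x\leq y$ iff $x*y=1$; (S2) if $y*x=1$ then $x*((x*y)*y)=1$; (S3) if $x*y=1$ then $(y*z)*(x*z)=1$; (S4) $L(U(x,y),x*y)=L(y)$; it is strong if $x*((x*y)*y)=1$ for all $x,y$. An algebraic congruence is a congruence of $(S,*)$; on $S/\Theta$ put $[a]\Theta*[b]\Theta=[a*b]\Theta$ and $[a]\Theta\leq'[b]\Theta$ iff $[a*b]\Theta=[1]\Theta$. An algebraic congruence $\Theta$ is strong if for all $a,b$: $[a]\Theta\leq'[b]\Theta$ iff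 there is $c\in[b]\Theta$ with $a\leq c$ and $b\leq c$. A relation $\rho$ is min-stable if $(a,b),(c,d)\in\rho$ with $a,c$ comparable and $b,d$ comparable imply $(\min(a,c),\min(b,d))\in\rho$. A strong congruence is a strong algebraic congruence that is min-stable. A subset is up-directed if any two of its elements have an upper bound in it. -}

module Defs where

open import Data.Nat using (ℕ; suc)
open import Data.Fin using (Fin)
open import Data.Product using (Σ; ∃; ∃-syntax; _×_; _,_)
open import Data.Sum using (_⊎_)
open import Function.Bundles using (_⇔_)
open import Relation.Binary.Structures using (IsPartialOrder; IsEquivalence)
open import Relation.Binary.PropositionalEquality using (_≡_)

module Bounds {S : Set} (_≤_ : S → S → Set) where
  U : (S → Set) → S → Set
  U A x = ∀ w → A w → w ≤ x

  L : (S → Set) → S → Set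
  L A x = ∀ w → A w → x ≤ w

  pair : S → S → S → Set
  pair x y w = (w ≡ x) ⊎ (w ≡ y)

  singleton : S → S → Set
  singleton x w = w ≡ x

  _∪_ : (S → Set) → (S → Set) → S → Set
  (A ∪ B) w = A w ⊎ B w

record SkewHilbertAlgebra : Set₁ where
  field
    Carrier        : Set
    _≤_            : Carrier → Carrier → Set
    _*_            : Carrier → Carrier → Carrier
    𝟏              : Carrier
    isPartialOrder : IsPartialOrder _≡_ _≤_
  open Bounds _≤_
  field
    S1 : ∀ x y → (x ≤ y) ⇔ (x * y ≡ 𝟏)
    S2 : ∀ x y → y * x ≡ 𝟏 → x * ((x * y) * y) ≡ 𝟏
    S3 : ∀ x y z → x * y ≡ 𝟏 → (y * z) * (x * z) ≡ 𝟏
    -- L(U(x,y), x*y) = L(y), as equality of subsets of the carrier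
    S4 : ∀ x y w → L (U (pair x y) ∪ singleton (x * y)) w ⇔ L (singleton y) w

module _ (𝐒 : SkewHilbertAlgebra) where
  open SkewHilbertAlgebra 𝐒
  open Bounds _≤_

  IsStrongAlgebra : Set
  IsStrongAlgebra = ∀ x y → x * ((x * y) * y) ≡ 𝟏

  record AlgebraicCongruence : Set₁ where
    field
      Θ             : Carrier → Carrier → Set
      isEquivalence : IsEquivalence Θ
      compatible    : ∀ {a b c d} → Θ a b → Θ c d → Θ (a * c) (b * d)

    -- [a]Θ ≤' [b]Θ  iff  [a * b]Θ = [1]Θ   (classes represented by elements,
    -- equality of classes being Θ)
    _≤′_ : Carrier → Carrier → Set
    a ≤′ b = Θ (a * b) 𝟏

  module _ (C : AlgebraicCongruence) where
    open AlgebraicCongruence C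

    IsStrongAlgCong : Set
    IsStrongAlgCong = ∀ a b → (a ≤′ b) ⇔ (∃[ c ] (Θ c b × a ≤ c × b ≤ c))

    IsMin : Carrier → Carrier → Carrier → Set
    IsMin a c m = (m ≡ a × a ≤ c) ⊎ (m ≡ c × c ≤ a)

    MinStable : Set
    MinStable = ∀ {a b c d m m′} → Θ a b → Θ c d → IsMin a c m → IsMin b d m′ → Θ m m′

    ClassesUpDirected : Set
    ClassesUpDirected = ∀ a x y → Θ x a → Θ y a → ∃[ z ] (Θ z a × x ≤ z × y ≤ z)

    -- {[x] | [a_i] ≤' [x] ∀ i} = {[x] | x ∈ U(a_1,…,a_n)}  as sets of classes
    UpperClassesEq : (n : ℕ) → (Fin n → Carrier) → Set
    UpperClassesEq n as =
      (∀ x → (∀ i → as i ≤′ x) → ∃[ y ] (U (λ w → ∃[ i ] (w ≡ as i)) y × Θ x y))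
      × (∀ x → U (λ w → ∃[ i ] (w ≡ as i)) x → ∃[ y ] ((∀ i → as i ≤′ y) × Θ x y))

-- Strongness of Θ says [a]Θ ≤′ [b]Θ exactly when [b]Θ contains an upper bound of a and b; in a strong
-- algebra such a bound is (a * b) * b, which is Θ-related to 𝟏 * b = b whenever a * b Θ 𝟏.
-- Everything else follows by composing such bounds: upper bounds of finitely many aᵢ are built one
-- element at a time, transitivity of ≤′ chains two bounds, and antisymmetry is min-stability applied
-- to the two bounds witnessing a ≤′ b and b ≤′ a.
module Submission where

open import Defs
open import Data.Nat using (ℕ; suc; zero)
open import Data.Fin using (Fin)
import Data.Fin as Fin
open import Data.Product using (_×_; _,_; ∃-syntax)
open import Data.Sum using (inj₁; inj₂)
open import Function.Bundles using (Equivalence; mk⇔)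
open import Relation.Binary.Structures using (IsPartialOrder; IsEquivalence)
open import Relation.Binary.PropositionalEquality using (_≡_; refl; sym; subst)

module SkewHilbertAlgebraProperties (𝐒 : SkewHilbertAlgebra) where
  open SkewHilbertAlgebra 𝐒
  open Bounds _≤_
  module PO = IsPartialOrder isPartialOrder

  ≤-refl : ∀ {x} → x ≤ x
  ≤-refl = PO.reflexive refl

  ≤⇒*≡𝟏 : ∀ {x y} → x ≤ y → x * y ≡ 𝟏
  ≤⇒*≡𝟏 {x} {y} = Equivalence.to (S1 x y)

  *≡𝟏⇒≤ : ∀ {x y} → x * y ≡ 𝟏 → x ≤ y
  *≡𝟏⇒≤ {x} {y} = Equivalence.from (S1 x y)

  x*x≡𝟏 : ∀ x → x * x ≡ 𝟏
  x*x≡𝟏 x = ≤⇒*≡𝟏 ≤-refl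

  ≤-singleton : ∀ y → L (singleton y) y
  ≤-singleton y w w≡y = subst (y ≤_) (sym w≡y) ≤-refl

  -- (S4) from right to left: y is below everything in U(x, y) ∪ {x * y}, in particular below x * y.
  y≤x*y : ∀ x y → y ≤ (x * y)
  y≤x*y x y = Equivalence.from (S4 x y y) (≤-singleton y) (x * y) (inj₂ refl)

  x≤𝟏 : ∀ x → x ≤ 𝟏
  x≤𝟏 x = subst (x ≤_) (x*x≡𝟏 x) (y≤x*y x x)

  𝟏*y≡y : ∀ y → 𝟏 * y ≡ y
  𝟏*y≡y y = PO.antisym 𝟏*y≤y (y≤x*y 𝟏 y)
    where
    lowerBound : L (U (pair 𝟏 y) ∪ singleton (𝟏 * y)) (𝟏 * y)
    lowerBound w (inj₁ w∈U) = PO.trans (x≤𝟏 _) (w∈U 𝟏 (inj₁ refl))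
    lowerBound w (inj₂ w≡𝟏*y) = ≤-singleton (𝟏 * y) w w≡𝟏*y

    𝟏*y≤y : (𝟏 * y) ≤ y
    𝟏*y≤y = Equivalence.to (S4 𝟏 y (𝟏 * y)) lowerBound y refl

module AlgebraicCongruenceProperties (𝐒 : SkewHilbertAlgebra) (C : AlgebraicCongruence 𝐒) where
  open SkewHilbertAlgebra 𝐒
  open AlgebraicCongruence C
  open Bounds _≤_
  open SkewHilbertAlgebraProperties 𝐒
  module Θ = IsEquivalence isEquivalence

  ≡⇒Θ : ∀ {x y} → x ≡ y → Θ x y
  ≡⇒Θ refl = Θ.refl

  ≤⇒≤′ : ∀ a b → a ≤ b → a ≤′ b
  ≤⇒≤′ a b a≤b = ≡⇒Θ (≤⇒*≡𝟏 a≤b)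

  ≤′-respʳ-Θ : ∀ {a x y} → Θ x y → a ≤′ y → a ≤′ x
  ≤′-respʳ-Θ x∼y a≤′y = Θ.trans (compatible Θ.refl x∼y) a≤′y

  ≤′-respˡ-Θ : ∀ {x y b} → Θ x y → y ≤′ b → x ≤′ b
  ≤′-respˡ-Θ x∼y y≤′b = Θ.trans (compatible x∼y Θ.refl) y≤′b

  ≤′-reflexive : ∀ {a b} → Θ a b → a ≤′ b
  ≤′-reflexive {b = b} a∼b = ≤′-respˡ-Θ a∼b (≡⇒Θ (x*x≡𝟏 b))

  ≤-related⇒≤′ : ∀ {a b c} → Θ c b → a ≤ c → a ≤′ b
  ≤-related⇒≤′ {a} {b} {c} c∼b a≤c = ≤′-respʳ-Θ (Θ.sym c∼b) (≤⇒≤′ a c a≤c)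

  strongAlgebra⇒strongAlgCong : IsStrongAlgebra 𝐒 → IsStrongAlgCong 𝐒 C
  strongAlgebra⇒strongAlgCong strong a b =
    mk⇔ commonUpperBound (λ (c , c∼b , a≤c , _) → ≤-related⇒≤′ c∼b a≤c)
    where
    commonUpperBound : a ≤′ b → ∃[ c ] (Θ c b × a ≤ c × b ≤ c)
    commonUpperBound a≤′b =
      (a * b) * b , Θ.trans (compatible a≤′b Θ.refl) (≡⇒Θ (𝟏*y≡y b)) , *≡𝟏⇒≤ (strong a b) , y≤x*y (a * b) b

  module Strong (strong : IsStrongAlgCong 𝐒 C) where

    ≤′⇒upperBound : ∀ {a b} → a ≤′ b → ∃[ c ] (Θ c b × a ≤ c × b ≤ c)
    ≤′⇒upperBound {a} {b} = Equivalence.to (strong a b)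

    classesUpDirected : ClassesUpDirected 𝐒 C
    classesUpDirected a x y x∼a y∼a with ≤′⇒upperBound (≤′-reflexive {x} {y} (Θ.trans x∼a (Θ.sym y∼a)))
    ... | c , c∼y , x≤c , y≤c = c , Θ.trans c∼y y∼a , x≤c , y≤c

    ≤′-all⇒related-upperBound : ∀ n (as : Fin n → Carrier) x →
      (∀ i → as i ≤′ x) → ∃[ y ] ((∀ i → as i ≤ y) × Θ x y)
    ≤′-all⇒related-upperBound zero as x _ = x , (λ ()) , Θ.refl
    ≤′-all⇒related-upperBound (suc n) as x as≤′x
      with ≤′-all⇒related-upperBound n (λ i → as (Fin.suc i)) x (λ i → as≤′x (Fin.suc i))
    ... | y , tail≤y , x∼y with ≤′⇒upperBound (≤′-respʳ-Θ (Θ.sym x∼y) (as≤′x Fin.zero))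
    ... | c , c∼y , a₀≤c , y≤c = c , as≤c , Θ.trans x∼y (Θ.sym c∼y)
      where
      as≤c : ∀ i → as i ≤ c
      as≤c Fin.zero    = a₀≤c
      as≤c (Fin.suc i) = PO.trans (tail≤y i) y≤c

    upperClassesEq : ∀ n (as : Fin n → Carrier) → UpperClassesEq 𝐒 C n as
    upperClassesEq n as = relatedUpperBound , λ x x∈U → x , (λ i → ≤⇒≤′ _ _ (x∈U (as i) (i , refl))) , Θ.refl
      where
      relatedUpperBound : ∀ x → (∀ i → as i ≤′ x) → ∃[ y ] (U (λ w → ∃[ i ] (w ≡ as i)) y × Θ x y)
      relatedUpperBound x as≤′x with ≤′-all⇒related-upperBound n as x as≤′x
      ... | y , as≤y , x∼y = y , (λ { w (i , refl) → as≤y i }) , x∼y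

    ≤′-trans : ∀ {a b c} → a ≤′ b → b ≤′ c → a ≤′ c
    ≤′-trans a≤′b b≤′c with ≤′⇒upperBound a≤′b
    ... | d , d∼b , a≤d , _ with ≤′⇒upperBound (≤′-respˡ-Θ d∼b b≤′c)
    ... | e , e∼c , d≤e , _ = ≤-related⇒≤′ e∼c (PO.trans a≤d d≤e)

    -- With upper bounds a ≤ d ∼ b and b ≤ e ∼ a, min-stability on (a, e) and (d, b) gives (min(a, d), min(e, b)) = (a, b).
    ≤′-antisym : MinStable 𝐒 C → ∀ {a b} → a ≤′ b → b ≤′ a → Θ a b
    ≤′-antisym minStable a≤′b b≤′a with ≤′⇒upperBound a≤′b | ≤′⇒upperBound b≤′a
    ... | d , d∼b , a≤d , _ | e , e∼a , b≤e , _ =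
      minStable (Θ.sym e∼a) d∼b (inj₁ (refl , a≤d)) (inj₂ (refl , b≤e))

    ≤′-isPartialOrder : MinStable 𝐒 C → IsPartialOrder Θ _≤′_
    ≤′-isPartialOrder minStable = record
      { isPreorder = record
        { isEquivalence = isEquivalence
        ; reflexive     = ≤′-reflexive
        ; trans         = ≤′-trans
        }
      ; antisym = ≤′-antisym minStable
      }

mainTheorem12 : (𝐒 : SkewHilbertAlgebra) (C : AlgebraicCongruence 𝐒) →
    let open SkewHilbertAlgebra 𝐒 in
    let open AlgebraicCongruence C in
    (∀ a b → a ≤ b → a ≤′ b)
    × (IsStrongAlgebra 𝐒 → IsStrongAlgCong 𝐒 C)
    × (IsStrongAlgCong 𝐒 C → ClassesUpDirected 𝐒 C)
    × (IsStrongAlgCong 𝐒 C → (n : ℕ) (as : Fin (suc n) → Carrier) → UpperClassesEq 𝐒 C (suc n) as)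
    × (IsStrongAlgCong 𝐒 C → MinStable 𝐒 C → IsPartialOrder Θ _≤′_)
mainTheorem12 𝐒 C =
    ≤⇒≤′
  , strongAlgebra⇒strongAlgCong
  , (λ strong → Strong.classesUpDirected strong)
  , (λ strong n → Strong.upperClassesEq strong (suc n))
  , (λ strong → Strong.≤′-isPartialOrder strong)
  where open AlgebraicCongruenceProperties 𝐒 C
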